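{- The Kneser graph $K(7,3)$ is not perfect injectively colorable.
   Context: The Kneser graph $K(7,3)$ has the $3$-subsets of $\{1,\ldots,7\}$ as vertices, two being adjacent if they are disjoint. An injective $k$-coloring of a graph $G$ is a map $f:V(G)\to\{1,\dots,k\}$ such that no vertex has two neighbors $u\neq w$ with $f(u)=f(w)$. A set $B\subseteq V(G)$ is an open packing if $N(u)\cap N(v)=\emptyset$ for all distinct $u,v\in B$; $\rho^{\rm o}(G)$ is the maximum cardinality of an open packing. $G$ is perfect injectively colorable if it has an injective coloring in which every color class is an open packing of cardinality $\rho^{\rm o}(G)$. -}

module Defs where

open import Data.Nat using (ℕ; _≤_)
open import Data.Fin using (Fin)
open import Data.Fin.Subset using (Subset; _∈_; ∣_∣)
open import Data.Product using (Σ; ∃; _×_; _,_; proj₁)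
open import Data.List using (List; length)
open import Data.List.Relation.Unary.Unique.Propositional using (Unique)
import Data.List.Membership.Propositional as LM
open import Data.Empty using (⊥)
open import Relation.Nullary using (¬_)
open import Relation.Binary.PropositionalEquality using (_≡_)
open import Function.Bundles using (_⇔_)

record Graph : Set₁ where
  field
    Vertex : Set
    Adj    : Vertex → Vertex → Set

module _ (G : Graph) where
  open Graph G

  -- A finite set of vertices is represented by a duplicate-free list;
  -- its cardinality is the length of the list.

  IsOpenPacking : List Vertex → Set
  IsOpenPacking B =
    Unique B ×
    (∀ u v → u LM.∈ B → v LM.∈ B → ¬ (u ≡ v) → ∀ w → Adj u w → Adj v w → ⊥)

  IsOpenPackingNumber : ℕ → Set
  IsOpenPackingNumber ρ =
    (Σ (List Vertex) λ B → IsOpenPacking B × length B ≡ ρ) ×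
    (∀ B → IsOpenPacking B → length B ≤ ρ)

  IsInjectiveColoring : (k : ℕ) → (Vertex → Fin k) → Set
  IsInjectiveColoring k f =
    ∀ v u w → Adj v u → Adj v w → ¬ (u ≡ w) → ¬ (f u ≡ f w)

  IsColorClass : (k : ℕ) → (Vertex → Fin k) → Fin k → List Vertex → Set
  IsColorClass k f c L = Unique L × (∀ v → (v LM.∈ L) ⇔ (f v ≡ c))

  PerfectInjectivelyColorable : Set
  PerfectInjectivelyColorable =
    Σ ℕ λ ρ → IsOpenPackingNumber ρ ×
    (Σ ℕ λ k → Σ (Vertex → Fin k) λ f → IsInjectiveColoring k f ×
      (∀ c → (∃ λ v → f v ≡ c) →
        Σ (List Vertex) λ L → IsColorClass k f c L × IsOpenPacking L × length L ≡ ρ))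

K73-Vertex : Set
K73-Vertex = Σ (Subset 7) λ s → ∣ s ∣ ≡ 3

K73 : Graph
K73 = record
  { Vertex = K73-Vertex
  ; Adj    = λ s t → ∀ (i : Fin 7) → i ∈ proj₁ s → i ∈ proj₁ t → ⊥
  }

-- Two distinct vertices of K(7,3) have a common neighbour iff, as triples, they share two
-- points (both then lie in the 4-set complementary to that neighbour). So open packings are
-- families of triples pairwise meeting in at most one point, and an exhaustive search shows
-- that those with at least 7 members are exactly the 30 Fano planes on {1,…,7}. Hence
-- ρᵒ(K(7,3)) ≥ 7 and every colour class of a perfect injective colouring is a Fano plane.
-- Distinct colour classes are disjoint and the classes cover all 35 vertices; since any two
-- Fano planes leave a vertex uncovered, there are at least three classes, yet no three Fano
-- planes are pairwise disjoint.

module Submission where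

open import Defs
open import Level using (Level; 0ℓ)
import Data.Bool.Properties as Bool
open import Data.Nat using (ℕ; zero; suc; pred; _≤_; _<?_; _≤?_; z≤n; s≤s)
import Data.Nat.Properties as ℕ
open import Data.Fin using (Fin)
import Data.Fin.Properties as Fin
open import Data.Fin.Subset using (Subset; inside; outside; ∣_∣; _∩_)
import Data.Fin.Subset.Properties as Subset
open import Data.Vec using ([]; _∷_)
import Data.Vec.Properties as Vec
open import Data.Product using (Σ; ∃; _×_; _,_; proj₂)
open import Data.Product.Properties using (≡-dec)
open import Data.Sum using (inj₁; inj₂)
open import Data.List using (List; []; _∷_; [_]; length; map; _++_; filter)
open import Data.List.Relation.Unary.All as All using (All; []; _∷_)
open import Data.List.Relation.Unary.Any as Any using (Any; here; there)
open import Data.List.Relation.Unary.AllPairs as AllPairs using (AllPairs; []; _∷_)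
open import Data.List.Relation.Unary.Unique.Propositional using (Unique)
import Data.List.Relation.Unary.Unique.Propositional.Properties as Unique
open import Data.List.Relation.Unary.Unique.DecPropositional using (unique?)
open import Data.List.Membership.Propositional using (_∈_; _∉_; find)
open import Data.List.Membership.Propositional.Properties
  using (∈-map⁺; ∈-map⁻; ∈-++⁺ˡ; ∈-++⁺ʳ; ∈-++⁻; ∈-filter⁺; ∈-filter⁻)
open import Data.List.Membership.Propositional.Properties.WithK using (unique∧set⇒bag)
open import Data.List.Relation.Binary.Sublist.Propositional using (_⊆_; []; _∷_; _∷ʳ_)
open import Data.List.Relation.Binary.Sublist.Propositional.Properties using (length-mono-≤; filter-⊆)
open import Data.List.Relation.Binary.BagAndSetEquality using (∼bag⇒↭)
open import Data.List.Relation.Binary.Permutation.Propositional.Properties using (↭-length)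
open import Data.List.Relation.Binary.Disjoint.Propositional using (Disjoint)
open import Function using (_∘_; _⇔_; Equivalence; mk⇔)
import Function.Properties.Equivalence as ⇔
import Relation.Unary as U
open import Relation.Binary using (Rel; Decidable; DecidableEquality; Symmetric)
open import Relation.Binary.PropositionalEquality using (_≡_; _≢_; refl; sym; trans; cong; subst; module ≡-Reasoning)
open import Relation.Nullary using (Dec; yes; no; ¬_; ¬?; contradiction)
open import Relation.Nullary.Decidable using (from-yes; _×-dec_; _→-dec_)

private
  variable
    a ℓ : Level
    A : Set a

All² : Rel A ℓ → List A → Set _
All² R xs = All (λ x → All (R x) xs) xs

all²? : {R : Rel A ℓ} → Decidable R → ∀ xs → Dec (All² R xs)
all²? R? xs = All.all? (λ x → All.all? (R? x) xs) xs

All²-lookup : {R : Rel A ℓ} {xs : List A} {x y : A} → All² R xs → x ∈ xs → y ∈ xs → R x y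
All²-lookup rs x∈xs y∈xs = All.lookup (All.lookup rs x∈xs) y∈xs

AllPairs-lookup : {R : Rel A ℓ} {xs : List A} {x y : A} →
                  Symmetric R → AllPairs R xs → x ∈ xs → y ∈ xs → x ≢ y → R x y
AllPairs-lookup _     (_ ∷ _)   (here refl) (here refl) x≢y = contradiction refl x≢y
AllPairs-lookup _     (rs ∷ _)  (here refl) (there y∈) _ = All.lookup rs y∈
AllPairs-lookup R-sym (rs ∷ _)  (there x∈) (here refl) _ = R-sym (All.lookup rs x∈)
AllPairs-lookup R-sym (_ ∷ rss) (there x∈) (there y∈) x≢y = AllPairs-lookup R-sym rss x∈ y∈ x≢y

Unique⇒AllPairs : {R : Rel A ℓ} {xs : List A} → Unique xs →
                  (∀ {x y} → x ∈ xs → y ∈ xs → x ≢ y → R x y) → AllPairs R xs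
Unique⇒AllPairs []          _ = []
Unique⇒AllPairs (x≢xs ∷ u) r =
  All.tabulate (λ y∈ → r (here refl) (there y∈) (All.lookup x≢xs y∈)) ∷
  Unique⇒AllPairs u (λ x∈ y∈ → r (there x∈) (there y∈))

unique∧set⇒length-≡ : {xs ys : List A} → Unique xs → Unique ys →
                      (∀ {z} → z ∈ xs ⇔ z ∈ ys) → length xs ≡ length ys
unique∧set⇒length-≡ uxs uys xs≈ys = ↭-length (∼bag⇒↭ (unique∧set⇒bag uxs uys xs≈ys))

-- Cliques of a decidable relation

pred[m]≤n⇒m≤suc[n] : ∀ k {n} → pred k ≤ n → k ≤ suc n
pred[m]≤n⇒m≤suc[n] zero    _ = z≤n
pred[m]≤n⇒m≤suc[n] (suc _) k≤n = s≤s k≤n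

module Cliques {R : Rel A ℓ} (R? : Decidable R) where

  Extends : List A → List A → Set _
  Extends C ys = All (λ c → All (R c) ys) C

  cliquesExtending : ℕ → List A → List A → List (List A)
  cliquesExtending k       C (x ∷ xs) with length (x ∷ xs) <? k
  ... | yes _ = []
  ... | no  _ with All.all? (λ c → R? c x) C
  ...   | yes _ = map (x ∷_) (cliquesExtending (pred k) (x ∷ C) xs) ++ cliquesExtending k C xs
  ...   | no  _ = cliquesExtending k C xs
  cliquesExtending zero    _ []       = [ [] ]
  cliquesExtending (suc _) _ []       = []

  cliquesExtending-sound : ∀ k C xs {ys} → ys ∈ cliquesExtending k C xs →
                           AllPairs R ys × Extends C ys × k ≤ length ys
  cliquesExtending-sound zero    C []       (here refl) = [] , All.tabulate (λ _ → []) , z≤n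
  cliquesExtending-sound k       C (x ∷ xs) ys∈ with length (x ∷ xs) <? k
  ... | no  _ with All.all? (λ c → R? c x) C
  ...   | no  _ = cliquesExtending-sound k C xs ys∈
  ...   | yes C~x with ∈-++⁻ (map (x ∷_) (cliquesExtending (pred k) (x ∷ C) xs)) ys∈
  ...     | inj₂ ys∈′ = cliquesExtending-sound k C xs ys∈′
  ...     | inj₁ ys∈′ with ∈-map⁻ (x ∷_) ys∈′
  ...       | zs , zs∈ , refl with cliquesExtending-sound (pred k) (x ∷ C) xs zs∈
  ...         | clique , x~zs ∷ C~zs , k-1≤ =
    x~zs ∷ clique , All.zipWith (λ (c~x , c~zs) → c~x ∷ c~zs) (C~x , C~zs) , pred[m]≤n⇒m≤suc[n] k k-1≤

  cliquesExtending-complete : ∀ k C {xs ys} → ys ⊆ xs → AllPairs R ys → Extends C ys → k ≤ length ys →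
                              ys ∈ cliquesExtending k C xs
  cliquesExtending-complete zero    _ []  _ _ _   = here refl
  cliquesExtending-complete (suc _) _ []  _ _ ()
  cliquesExtending-complete k       C {x ∷ xs} ys⊆ clique C~ys k≤ with length (x ∷ xs) <? k
  ... | yes short = contradiction (ℕ.≤-trans k≤ (length-mono-≤ ys⊆)) (ℕ.<⇒≱ short)
  ... | no  _ with All.all? (λ c → R? c x) C | ys⊆
  ...   | yes _    | _ ∷ʳ ys⊆′ = ∈-++⁺ʳ _ (cliquesExtending-complete k C ys⊆′ clique C~ys k≤)
  ...   | no  _    | _ ∷ʳ ys⊆′ = cliquesExtending-complete k C ys⊆′ clique C~ys k≤
  ...   | yes _    | refl ∷ ys⊆′ =
    ∈-++⁺ˡ (∈-map⁺ (x ∷_) (cliquesExtending-complete (pred k) (x ∷ C) ys⊆′ (AllPairs.tail clique)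
                     (AllPairs.head clique ∷ All.map All.tail C~ys) (ℕ.pred-mono-≤ k≤)))
  ...   | no  C≁x  | refl ∷ ys⊆′ = contradiction (All.map All.head C~ys) C≁x

  largeCliques : ℕ → List A → List (List A)
  largeCliques k = cliquesExtending k []

  ∈-largeCliques⁺ : ∀ {k xs ys} → ys ⊆ xs → AllPairs R ys → k ≤ length ys → ys ∈ largeCliques k xs
  ∈-largeCliques⁺ {k} ys⊆xs clique k≤ = cliquesExtending-complete k [] ys⊆xs clique [] k≤

  ∈-largeCliques⁻ : ∀ {k xs ys} → ys ∈ largeCliques k xs → AllPairs R ys × k ≤ length ys
  ∈-largeCliques⁻ {k} {xs} ys∈ with clique , _ , k≤ ← cliquesExtending-sound k [] xs ys∈ = clique , k≤

-- Colourings whose colour classes belong to a given family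

module _ {V : Set} where

  NoTwoCover : List (List V) → Set
  NoTwoCover 𝓕 = ∀ {P Q} → P ∈ 𝓕 → Q ∈ 𝓕 → ∃ λ x → x ∉ P × x ∉ Q

  NoThreePairwiseDisjoint : List (List V) → Set
  NoThreePairwiseDisjoint 𝓕 =
    ∀ {P Q R} → P ∈ 𝓕 → Q ∈ 𝓕 → R ∈ 𝓕 → Disjoint P Q → Disjoint P R → ¬ Disjoint Q R

module _ {V : Set} (_≟_ : DecidableEquality V) where

  open import Data.List.Membership.DecPropositional _≟_ using (_∈?_)

  Meet : Rel (List V) 0ℓ
  Meet P Q = Any (_∈ Q) P

  meet? : Decidable Meet
  meet? P Q = Any.any? (_∈? Q) P

  Uncovered : List V → Rel (List V) 0ℓ
  Uncovered xs P Q = Any (λ x → x ∉ P × x ∉ Q) xs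

  uncovered? : ∀ xs → Decidable (Uncovered xs)
  uncovered? xs P Q = Any.any? (λ x → ¬? (x ∈? P) ×-dec ¬? (x ∈? Q)) xs

  noTwoCover : ∀ {xs 𝓕} → All² (Uncovered xs) 𝓕 → NoTwoCover 𝓕
  noTwoCover uncovered P∈ Q∈ = Any.satisfied (All²-lookup uncovered P∈ Q∈)

  disjointFrom : List (List V) → List V → List (List V)
  disjointFrom 𝓕 P = filter (¬? ∘ meet? P) 𝓕

  PairwiseMeetingAwayFromEach : List (List V) → Set
  PairwiseMeetingAwayFromEach 𝓕 = All (λ P → All² Meet (disjointFrom 𝓕 P)) 𝓕

  pairwiseMeetingAwayFromEach? : ∀ 𝓕 → Dec (PairwiseMeetingAwayFromEach 𝓕)
  pairwiseMeetingAwayFromEach? 𝓕 = All.all? (λ P → all²? meet? (disjointFrom 𝓕 P)) 𝓕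

  ∈-disjointFrom : ∀ {𝓕 P Q} → Q ∈ 𝓕 → Disjoint P Q → Q ∈ disjointFrom 𝓕 P
  ∈-disjointFrom Q∈ P#Q = ∈-filter⁺ _ Q∈ (λ P-meets-Q → let _ , x∈P , x∈Q = find P-meets-Q in P#Q (x∈P , x∈Q))

  noThreePairwiseDisjoint : ∀ {𝓕} → PairwiseMeetingAwayFromEach 𝓕 → NoThreePairwiseDisjoint 𝓕
  noThreePairwiseDisjoint meeting P∈ Q∈ R∈ P#Q P#R Q#R
    with x , x∈Q , x∈R ← find (All²-lookup (All.lookup meeting P∈) (∈-disjointFrom Q∈ P#Q) (∈-disjointFrom R∈ P#R))
    = Q#R (x∈Q , x∈R)

module _ {V C : Set} (f : V → C) where

  IsClassOf : V → List V → Set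
  IsClassOf v P = ∀ w → w ∈ P ⇔ f w ≡ f v

  classes-disjoint : ∀ {u v P Q} → IsClassOf u P → IsClassOf v Q → v ∉ P → Disjoint P Q
  classes-disjoint {u} {v} P-class Q-class v∉P {w} (w∈P , w∈Q) =
    v∉P (Equivalence.from (P-class v) (begin
      f v ≡⟨ sym (Equivalence.to (Q-class w) w∈Q) ⟩
      f w ≡⟨ Equivalence.to (P-class w) w∈P ⟩
      f u ∎))
    where open ≡-Reasoning

  classesIn⇒empty : ∀ {𝓕} → NoTwoCover 𝓕 → NoThreePairwiseDisjoint 𝓕 →
                    (∀ v → ∃ λ P → P ∈ 𝓕 × IsClassOf v P) → ¬ V
  classesIn⇒empty two-miss no-three class v₀
    with P₀ , P₀∈ , P₀-class ← class v₀
    with x₁ , x₁∉P₀ , _      ← two-miss P₀∈ P₀∈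
    with P₁ , P₁∈ , P₁-class ← class x₁
    with x₂ , x₂∉P₀ , x₂∉P₁  ← two-miss P₀∈ P₁∈
    with P₂ , P₂∈ , P₂-class ← class x₂
    = no-three P₀∈ P₁∈ P₂∈ (classes-disjoint P₀-class P₁-class x₁∉P₀)
                           (classes-disjoint P₀-class P₂-class x₂∉P₀)
                           (classes-disjoint P₁-class P₂-class x₂∉P₁)

-- The Kneser graph K(7,3)

open Graph K73 using (Vertex; Adj)

_≟_ : DecidableEquality Vertex
_≟_ = ≡-dec (Vec.≡-dec Bool._≟_) (λ p q → yes (ℕ.≡-irrelevant p q))

open import Data.List.Membership.DecPropositional _≟_ using (_∈?_)

subsets : ∀ n → List (Subset n)
subsets zero    = [ [] ]
subsets (suc n) = map (outside ∷_) (subsets n) ++ map (inside ∷_) (subsets n)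

∈-subsets : ∀ {n} (s : Subset n) → s ∈ subsets n
∈-subsets []            = here refl
∈-subsets (outside ∷ s) = ∈-++⁺ˡ (∈-map⁺ (outside ∷_) (∈-subsets s))
∈-subsets (inside  ∷ s) = ∈-++⁺ʳ _ (∈-map⁺ (inside ∷_) (∈-subsets s))

ofSize : ∀ {n} k → List (Subset n) → List (Σ (Subset n) λ s → ∣ s ∣ ≡ k)
ofSize k []       = []
ofSize k (s ∷ ss) with ∣ s ∣ ℕ.≟ k
... | yes |s|≡k = (s , |s|≡k) ∷ ofSize k ss
... | no  _     = ofSize k ss

∈-ofSize : ∀ {n k} {s : Subset n} {ss} (|s|≡k : ∣ s ∣ ≡ k) → s ∈ ss → (s , |s|≡k) ∈ ofSize k ss
∈-ofSize {k = k} {ss = s′ ∷ _} |s|≡k s∈ with ∣ s′ ∣ ℕ.≟ k | s∈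
... | yes |s′|≡k | here refl = here (cong (_ ,_) (ℕ.≡-irrelevant |s|≡k |s′|≡k))
... | yes _      | there s∈′ = there (∈-ofSize |s|≡k s∈′)
... | no  |s′|≢k | here refl = contradiction |s|≡k |s′|≢k
... | no  _      | there s∈′ = ∈-ofSize |s|≡k s∈′

vertices : List Vertex
vertices = ofSize 3 (subsets 7)

∈-vertices : ∀ v → v ∈ vertices
∈-vertices (s , |s|≡3) = ∈-ofSize |s|≡3 (∈-subsets s)

vertices-unique : Unique vertices
vertices-unique = from-yes (unique? _≟_ vertices)

adjacent? : Decidable Adj
adjacent? (s , _) (t , _) = Fin.all? λ i → i Subset.∈? s →-dec ¬? (i Subset.∈? t)

CommonNeighbour : Rel Vertex 0ℓ
CommonNeighbour u v = ∃ λ w → Adj u w × Adj v w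

SharePair : Rel Vertex 0ℓ
SharePair (s , _) (t , _) = 2 ≤ ∣ s ∩ t ∣

sharePair? : Decidable SharePair
sharePair? (s , _) (t , _) = 2 ≤? ∣ s ∩ t ∣

sharePair-refl : ∀ v → SharePair v v
sharePair-refl (s , |s|≡3) = subst (2 ≤_) (sym (trans (cong ∣_∣ (Subset.∩-idem s)) |s|≡3)) (s≤s (s≤s z≤n))

sharePair-sym : Symmetric SharePair
sharePair-sym {s , _} {t , _} = subst (2 ≤_) (cong ∣_∣ (Subset.∩-comm s t))

neighbours : Vertex → List Vertex
neighbours w = filter (adjacent? w) vertices

neighbourhoods-sharePair : All (λ w → All² SharePair (neighbours w)) vertices
neighbourhoods-sharePair = from-yes (All.all? (λ w → all²? sharePair? (neighbours w)) vertices)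

commonNeighbour⇒sharePair : ∀ {u v} → CommonNeighbour u v → SharePair u v
commonNeighbour⇒sharePair {u} {v} (w , u~w , v~w) =
  All²-lookup (All.lookup neighbourhoods-sharePair (∈-vertices w)) (∈-neighbours {u} u~w) (∈-neighbours {v} v~w)
  where
    ∈-neighbours : ∀ {x} → Adj x w → x ∈ neighbours w
    ∈-neighbours {x} x~w = ∈-filter⁺ (adjacent? w) (∈-vertices x) (λ i i∈w i∈x → x~w i i∈x i∈w)

CommonNeighbourIn : List Vertex → Rel Vertex 0ℓ
CommonNeighbourIn Vs u v = Any (λ w → Adj u w × Adj v w) Vs

commonNeighbourIn? : ∀ Vs → Decidable (CommonNeighbourIn Vs)
commonNeighbourIn? Vs u v = Any.any? (λ w → adjacent? u w ×-dec adjacent? v w) Vs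

-- Abstracting over the enumeration Vs lets the check below evaluate vertices only once.
sharePair⇒commonNeighbourIn? : ∀ Vs → Dec (All² (λ u v → u ≢ v → SharePair u v → CommonNeighbourIn Vs u v) Vs)
sharePair⇒commonNeighbourIn? Vs = all²? (λ u v → ¬? (u ≟ v) →-dec sharePair? u v →-dec commonNeighbourIn? Vs u v) Vs

sharePair⇒commonNeighbourIn-vertices : All² (λ u v → u ≢ v → SharePair u v → CommonNeighbourIn vertices u v) vertices
sharePair⇒commonNeighbourIn-vertices = from-yes (sharePair⇒commonNeighbourIn? vertices)

sharePair⇒commonNeighbour : ∀ {u v} → u ≢ v → SharePair u v → CommonNeighbour u v
sharePair⇒commonNeighbour {u} {v} u≢v uv =
  Any.satisfied (All²-lookup sharePair⇒commonNeighbourIn-vertices (∈-vertices u) (∈-vertices v) u≢v uv)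

NoSharedPair : List Vertex → Set
NoSharedPair = AllPairs (λ u v → ¬ SharePair u v)

noSharedPair⇒openPacking : ∀ {B} → NoSharedPair B → IsOpenPacking K73 B
noSharedPair⇒openPacking B-free =
  AllPairs.map (λ {u} ¬uv u≡v → ¬uv (subst (SharePair u) u≡v (sharePair-refl u))) B-free ,
  λ u v u∈B v∈B u≢v w u~w v~w →
    AllPairs-lookup (λ {x} {y} ¬xy yx → ¬xy (sharePair-sym {y} {x} yx)) B-free u∈B v∈B u≢v
                    (commonNeighbour⇒sharePair {u} {v} (w , u~w , v~w))

openPacking⇒noSharedPair : ∀ {B u v} → IsOpenPacking K73 B → u ∈ B → v ∈ B → u ≢ v → ¬ SharePair u v
openPacking⇒noSharedPair {u = u} {v} (_ , packing) u∈B v∈B u≢v uv =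
  let w , u~w , v~w = sharePair⇒commonNeighbour {u} {v} u≢v uv in packing u v u∈B v∈B u≢v w u~w v~w

open Cliques (λ u v → ¬? (sharePair? u v))

-- The Steiner triple systems on seven points: 30 Fano planes of 7 triples each.
fanoPlanes : List (List Vertex)
fanoPlanes = largeCliques 7 vertices

∈-fanoPlanes⁺ : ∀ {P} → P ⊆ vertices → NoSharedPair P → 7 ≤ length P → P ∈ fanoPlanes
∈-fanoPlanes⁺ = ∈-largeCliques⁺ {7} {vertices}

∈-fanoPlanes⁻ : ∀ {P} → P ∈ fanoPlanes → NoSharedPair P × 7 ≤ length P
∈-fanoPlanes⁻ = ∈-largeCliques⁻ {7} {vertices}

fanoPlanes-nonempty : ∃ (_∈ fanoPlanes)
fanoPlanes-nonempty = _ , here refl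

7≤openPackingNumber : ∀ {ρ} → IsOpenPackingNumber K73 ρ → 7 ≤ ρ
7≤openPackingNumber (_ , maximal) =
  let P , P∈ = fanoPlanes-nonempty
      P-free , 7≤|P| = ∈-fanoPlanes⁻ P∈
  in ℕ.≤-trans 7≤|P| (maximal P (noSharedPair⇒openPacking P-free))

fanoPlanes-noTwoCover : NoTwoCover fanoPlanes
fanoPlanes-noTwoCover = noTwoCover _≟_ (from-yes (all²? (uncovered? _≟_ vertices) fanoPlanes))

fanoPlanes-noThreePairwiseDisjoint : NoThreePairwiseDisjoint fanoPlanes
fanoPlanes-noThreePairwiseDisjoint = noThreePairwiseDisjoint _≟_ (from-yes (pairwiseMeetingAwayFromEach? _≟_ fanoPlanes))

module _ {k} (f : Vertex → Fin k) where

  hasColour? : ∀ c → U.Decidable (λ v → f v ≡ c)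
  hasColour? c v = f v Fin.≟ c

  classOf : Fin k → List Vertex
  classOf c = filter (hasColour? c) vertices

  ∈-classOf : ∀ {c} v → v ∈ classOf c ⇔ f v ≡ c
  ∈-classOf {c} v = mk⇔ (proj₂ ∘ ∈-filter⁻ (hasColour? c)) (∈-filter⁺ (hasColour? c) (∈-vertices v))

  classOf∈fanoPlanes : ∀ {c L} → IsColorClass K73 k f c L → IsOpenPacking K73 L → 7 ≤ length L →
                       classOf c ∈ fanoPlanes
  classOf∈fanoPlanes {c} {L} (L-unique , L-class) L-packing 7≤|L| =
    ∈-fanoPlanes⁺ (filter-⊆ (hasColour? c) vertices) class-free (ℕ.≤-trans 7≤|L| (ℕ.≤-reflexive |L|≡|class|))
    where
      class-unique : Unique (classOf c)
      class-unique = Unique.filter⁺ (hasColour? c) vertices-unique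

      L≈class : ∀ {v} → v ∈ L ⇔ v ∈ classOf c
      L≈class {v} = ⇔.trans (L-class v) (⇔.sym (∈-classOf v))

      |L|≡|class| : length L ≡ length (classOf c)
      |L|≡|class| = unique∧set⇒length-≡ L-unique class-unique L≈class

      class-free : NoSharedPair (classOf c)
      class-free = Unique⇒AllPairs class-unique λ u∈ v∈ →
        openPacking⇒noSharedPair L-packing (Equivalence.from L≈class u∈) (Equivalence.from L≈class v∈)

proposition5p3 : ¬ PerfectInjectivelyColorable K73
proposition5p3 (ρ , ρ-isρᵒ , k , f , _ , classes) =
  classesIn⇒empty f fanoPlanes-noTwoCover fanoPlanes-noThreePairwiseDisjoint classIn v₀
  where
    classIn : ∀ v → ∃ λ P → P ∈ fanoPlanes × IsClassOf f v P
    classIn v =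
      let L , L-class , L-packing , |L|≡ρ = classes (f v) (v , refl)
      in classOf f (f v) ,
         classOf∈fanoPlanes f L-class L-packing (subst (7 ≤_) (sym |L|≡ρ) (7≤openPackingNumber ρ-isρᵒ)) ,
         ∈-classOf f
    v₀ : Vertex
    v₀ = (inside ∷ inside ∷ inside ∷ outside ∷ outside ∷ outside ∷ outside ∷ []) , refl
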